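{- Let $A=\mathbb{Z}[\rho]$ with $\rho=e^{2\pi i/6}$, let $f$ be an integral binary hermitian form over $\mathbb{Q}(\sqrt{ -3})$, and let $(\mathbf u,\mathbf v)$ be a basis of the $A$-module $A^2$. Put $a=f(\mathbf u)$, $b=f(\mathbf v)$, $c=f(\mathbf u+\mathbf v)$, $d=f(\mathbf u+\rho\mathbf v)$ and $\alpha=b+c+d-2a$, $\beta=a+c+d-2b$, $\gamma=a+b+d-2c$, $\delta=a+b+c-2d$. Then for all $x,y$, $$f(x\mathbf u+y\mathbf v)=\tfrac13\big[\beta N(x)+\alpha N(y)+\gamma N(x-y)+\delta N(\rho x-y)\big],$$ and the discriminant of $f$ is $$\Delta=a^2+b^2+c^2+d^2-ab-ac-ad-bc-bd-cd=-\frac{\alpha a+\beta b+\gamma c+\delta d}{2}.$$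
   Context: $N(x)=|x|^2$. A binary hermitian form over $k=\mathbb{Q}(\sqrt{ -3})$ is $f(x,y)=a'N(x)+c'N(y)+\nu x\bar y+\bar\nu\bar xy$ with $a',c'\in\mathbb{Q}$, $\nu\in k$; it is integral if $f(A^2)\subseteq\mathbb{Z}$. Its discriminant is $\Delta=D(a'c'-N(\nu))$ with $D=-3$, computed from the matrix $\begin{pmatrix}a'&\nu\\ \bar\nu&c'\end{pmatrix}$ of $f$ in any basis of $A^2$ (the value does not depend on the basis of $A^2$). -}

module Defs where

open import Data.Integer as ℤ using (ℤ)
open import Data.Rational as ℚ using (ℚ; 0ℚ; 1ℚ)
open import Data.Product using (_×_; _,_; Σ; ∃-syntax)
open import Relation.Binary.PropositionalEquality using (_≡_)

-- The field k = ℚ(√-3) = ℚ(ρ), ρ = e^{2πi/6}, which satisfies ρ² = ρ - 1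
-- and ρ̄ = 1 - ρ.  An element p + qρ is stored as (p , q).

record K : Set where
  constructor _+ρ_
  field re im : ℚ
open K public

infix 4 _+ρ_ _+ρᴬ_

infixl 6 _+ₖ_ _-ₖ_
infixl 7 _*ₖ_

_+ₖ_ : K → K → K
(p +ρ q) +ₖ (r +ρ s) = (p ℚ.+ r) +ρ (q ℚ.+ s)

infix 8 -ₖ_
-ₖ_ : K → K
-ₖ (p +ρ q) = ℚ.- p +ρ ℚ.- q

_-ₖ_ : K → K → K
x -ₖ y = x +ₖ (-ₖ y)

-- (p + qρ)(r + sρ) = pr + (ps + qr) ρ + qs ρ²,  ρ² = ρ - 1
_*ₖ_ : K → K → K
(p +ρ q) *ₖ (r +ρ s) = (p ℚ.* r ℚ.- q ℚ.* s) +ρ (p ℚ.* s ℚ.+ q ℚ.* r ℚ.+ q ℚ.* s)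

-- complex conjugation: conj(p + qρ) = p + q(1 - ρ)
conj : K → K
conj (p +ρ q) = (p ℚ.+ q) +ρ (ℚ.- q)

ιℚ : ℚ → K
ιℚ p = p +ρ 0ℚ

ρₖ : K
ρₖ = 0ℚ +ρ 1ℚ

N : K → K
N x = x *ₖ conj x

-- The ring A = ℤ[ρ], element m + nρ stored as (m , n), embedded in k.

record A : Set where
  constructor _+ρᴬ_
  field reᴬ imᴬ : ℤ
open A public

ιA : A → K
ιA (m +ρᴬ n) = (m ℚ./ 1) +ρ (n ℚ./ 1)

_+ᴬ_ : A → A → A
(m +ρᴬ n) +ᴬ (m' +ρᴬ n') = (m ℤ.+ m') +ρᴬ (n ℤ.+ n')

_*ᴬ_ : A → A → A
(m +ρᴬ n) *ᴬ (m' +ρᴬ n') = (m ℤ.* m' ℤ.- n ℤ.* n') +ρᴬ (m ℤ.* n' ℤ.+ n ℤ.* m' ℤ.+ n ℤ.* n')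

ρᴬ : A
ρᴬ = ℤ.0ℤ +ρᴬ ℤ.1ℤ

oneᴬ : A
oneᴬ = ℤ.1ℤ +ρᴬ ℤ.0ℤ

A² : Set
A² = A × A

_+²_ : A² → A² → A²
(x₁ , x₂) +² (y₁ , y₂) = (x₁ +ᴬ y₁) , (x₂ +ᴬ y₂)

_·²_ : A → A² → A²
a ·² (x₁ , x₂) = (a *ᴬ x₁) , (a *ᴬ x₂)

_·ₖ_ : K → A² → K × K
x ·ₖ (u₁ , u₂) = (x *ₖ ιA u₁) , (x *ₖ ιA u₂)

_+ₖ²_ : K × K → K × K → K × K
(x₁ , x₂) +ₖ² (y₁ , y₂) = (x₁ +ₖ y₁) , (x₂ +ₖ y₂)

ιA² : A² → K × K
ιA² (x₁ , x₂) = ιA x₁ , ιA x₂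

IsBasis : A² → A² → Set
IsBasis u v = (w : A²) →
  Σ (A × A) λ { (x , y) → ((x ·² u) +² (y ·² v) ≡ w)
    × ((x' y' : A) → (x' ·² u) +² (y' ·² v) ≡ w → (x' , y') ≡ (x , y)) }

record HermForm : Set where
  constructor hermForm
  field
    a' c' : ℚ
    ν : K
open HermForm public

evalForm : HermForm → K × K → K
evalForm f (x , y) =
  ιℚ (a' f) *ₖ N x +ₖ ιℚ (c' f) *ₖ N y
    +ₖ ν f *ₖ x *ₖ conj y +ₖ conj (ν f) *ₖ conj x *ₖ y

IsIntegral : HermForm → Set
IsIntegral f = (w : A²) → ∃[ n ] evalForm f (ιA² w) ≡ ιℚ (n ℚ./ 1)

Dk : ℚ
Dk = ℤ.- (ℤ.+ 3) ℚ./ 1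

-- discriminant Δ = D (a'c' - N(ν)), computed from the matrix of f in the
-- standard basis of A²;  N(p + qρ) = p² + pq + q² ∈ ℚ
Nℚ : K → ℚ
Nℚ (p +ρ q) = p ℚ.* p ℚ.+ p ℚ.* q ℚ.+ q ℚ.* q

disc : HermForm → ℚ
disc f = Dk ℚ.* (a' f ℚ.* c' f ℚ.- Nℚ (ν f))

⅓ₖ : K
⅓ₖ = ιℚ (ℤ.+ 1 ℚ./ 3)

½ₖ : K
½ₖ = ιℚ (ℤ.+ 1 ℚ./ 2)

twoₖ : K
twoₖ = ιℚ (ℤ.+ 2 ℚ./ 1)

{-# OPTIONS --safe #-}
-- A change of basis (u, v) of A² pulls f back to the form g(x, y) = f(x u + y v), so all
-- three identities reduce to the standard basis, where they are polynomial identities in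
-- the coefficients a', c', ν and are checked by the ring solver over ℚ (elements of k being
-- pairs of rationals).  The discriminant changes by the factor N(det(u, v)); since (u, v)
-- is a basis, det(u, v) is a unit of A, so this factor is 1.
module Submission where

open import Defs
open import Data.Fin using (Fin; zero; suc; #_)
open import Data.Integer as ℤ using (ℤ; +_; -[1+_]; +≤+; 0ℤ; 1ℤ)
import Data.Integer.Properties as ℤP
open import Data.Integer.Tactic.RingSolver using (solve-∀)
open import Data.Nat as ℕ using (ℕ; z≤n)
import Data.Nat.Properties as ℕP
open import Data.Product using (_×_; _,_; proj₁; proj₂)
open import Data.Rational as ℚ using (ℚ; 0ℚ; 1ℚ)
import Data.Rational.Properties as ℚP
import Data.Rational.Unnormalised as ℚᵘ
import Data.Rational.Unnormalised.Properties as ℚᵘP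
open import Data.Vec.Base using (Vec; []; _∷_)
open import Level using (0ℓ)
open import Relation.Binary.PropositionalEquality
open import Relation.Nullary.Decidable using (dec⇒maybe)
import Tactic.RingSolver.Core.AlmostCommutativeRing as ACR

open ≡-Reasoning

toℚ : ℤ → ℚ
toℚ i = i ℚ./ 1

toℚᵘ-toℚ : ∀ i → ℚ.toℚᵘ (toℚ i) ℚᵘ.≃ ℚᵘ.mkℚᵘ i 0
toℚᵘ-toℚ i = ℚP.toℚᵘ-fromℚᵘ (ℚᵘ.mkℚᵘ i 0)

toℚ-unique : ∀ i p → ℚ.toℚᵘ p ℚᵘ.≃ ℚᵘ.mkℚᵘ i 0 → toℚ i ≡ p
toℚ-unique i p p≃i = trans (ℚP.fromℚᵘ-cong (ℚᵘP.≃-sym p≃i)) (ℚP.fromℚᵘ-toℚᵘ p)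

toℚ-injective : ∀ {i j} → toℚ i ≡ toℚ j → i ≡ j
toℚ-injective {i} {j} eq with ℚP.fromℚᵘ-injective {ℚᵘ.mkℚᵘ i 0} {ℚᵘ.mkℚᵘ j 0} eq
... | ℚᵘ.*≡* i*1≡j*1 = trans (sym (ℤP.*-identityʳ i)) (trans i*1≡j*1 (ℤP.*-identityʳ j))

toℚ-homo-+ : ∀ i j → toℚ (i ℤ.+ j) ≡ toℚ i ℚ.+ toℚ j
toℚ-homo-+ i j = toℚ-unique (i ℤ.+ j) (toℚ i ℚ.+ toℚ j)
  (ℚᵘP.≃-trans (ℚP.toℚᵘ-homo-+ (toℚ i) (toℚ j))
  (ℚᵘP.≃-trans (ℚᵘP.+-cong (toℚᵘ-toℚ i) (toℚᵘ-toℚ j))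
    (ℚᵘ.*≡* (cong (ℤ._* 1ℤ) (cong₂ ℤ._+_ (ℤP.*-identityʳ i) (ℤP.*-identityʳ j))))))

toℚ-homo-* : ∀ i j → toℚ (i ℤ.* j) ≡ toℚ i ℚ.* toℚ j
toℚ-homo-* i j = toℚ-unique (i ℤ.* j) (toℚ i ℚ.* toℚ j)
  (ℚᵘP.≃-trans (ℚP.toℚᵘ-homo-* (toℚ i) (toℚ j)) (ℚᵘP.*-cong (toℚᵘ-toℚ i) (toℚᵘ-toℚ j)))

toℚ-homo‿- : ∀ i → toℚ (ℤ.- i) ≡ ℚ.- toℚ i
toℚ-homo‿- i = toℚ-unique (ℤ.- i) (ℚ.- toℚ i)
  (ℚᵘP.≃-trans (ℚP.toℚᵘ-homo‿- (toℚ i)) (ℚᵘP.-‿cong (toℚᵘ-toℚ i)))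

-ᴬ_ : A → A
-ᴬ (m +ρᴬ n) = ℤ.- m +ρᴬ ℤ.- n

zeroᴬ : A
zeroᴬ = 0ℤ +ρᴬ 0ℤ

normᴬ : A → ℤ
normᴬ (m +ρᴬ n) = m ℤ.* m ℤ.+ m ℤ.* n ℤ.+ n ℤ.* n

detᴬ : A² → A² → A
detᴬ (u₁ , u₂) (v₁ , v₂) = (u₁ *ᴬ v₂) +ᴬ (-ᴬ (u₂ *ᴬ v₁))

0≤i*i : ∀ i → 0ℤ ℤ.≤ i ℤ.* i
0≤i*i (+ n) = subst (0ℤ ℤ.≤_) (sym (ℤP.+◃n≡+n (n ℕ.* n))) (+≤+ z≤n)
0≤i*i -[1+ n ] = +≤+ z≤n

normᴬ-nonNeg : ∀ w → 0ℤ ℤ.≤ normᴬ w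
normᴬ-nonNeg w@(m +ρᴬ n) = ℤP.*-cancelˡ-≤-pos 0ℤ (normᴬ w) (+ 4)
  (subst (0ℤ ℤ.≤_) (sym (four-normᴬ m n))
    (ℤP.+-mono-≤ (0≤i*i (m ℤ.+ m ℤ.+ n)) (ℤP.+-mono-≤ (ℤP.+-mono-≤ (0≤i*i n) (0≤i*i n)) (0≤i*i n))))
  where
  four-normᴬ : ∀ m n → + 4 ℤ.* (m ℤ.* m ℤ.+ m ℤ.* n ℤ.+ n ℤ.* n)
                     ≡ (m ℤ.+ m ℤ.+ n) ℤ.* (m ℤ.+ m ℤ.+ n) ℤ.+ (n ℤ.* n ℤ.+ n ℤ.* n ℤ.+ n ℤ.* n)
  four-normᴬ = solve-∀

nonNeg-unit : ∀ {i} j → 0ℤ ℤ.≤ i → i ℤ.* j ≡ 1ℤ → i ≡ 1ℤ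
nonNeg-unit {+ n} j _ ij≡1 =
  cong +_ (ℕP.m*n≡1⇒m≡1 n ℤ.∣ j ∣ (trans (sym (ℤP.abs-* (+ n) j)) (cong ℤ.∣_∣ ij≡1)))

-- The formulas of the paper, written once over any carrier with the operations of k: they are
-- instantiated at k itself and at polynomial expressions, on which the ring solver works.
record KOperations (C : Set) : Set where
  infixl 6 _+_
  infixl 7 _*_
  infix 8 -_
  field
    _+_ _*_ : C → C → C
    -_ conjugate : C → C
    real : C → C
    0# 1# 2# ⅓ ½ ρ : C

module Formulas {C : Set} (ops : KOperations C) where
  open KOperations ops

  infixl 6 _-_
  infixr 25 _⋆_
  infixl 20 _⊞_

  _-_ : C → C → C
  x - y = x + (- y)

  norm : C → C
  norm x = x * conjugate x

  form : C × C × C → C × C → C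
  form (a , c , ν) (x , y) = a * norm x + c * norm y + ν * x * conjugate y + conjugate ν * conjugate x * y

  sesquilinear : C × C × C → C × C → C × C → C
  sesquilinear (a , c , ν) (u₁ , u₂) (v₁ , v₂) =
    a * u₁ * conjugate v₁ + c * u₂ * conjugate v₂ + ν * u₁ * conjugate v₂ + conjugate ν * u₂ * conjugate v₁

  pullback : C × C × C → C × C → C × C → C × C × C
  pullback f u v = real (form f u) , real (form f v) , sesquilinear f u v

  _⋆_ : C → C × C → C × C
  x ⋆ (u₁ , u₂) = x * u₁ , x * u₂

  _⊞_ : C × C → C × C → C × C
  (u₁ , u₂) ⊞ (v₁ , v₂) = u₁ + v₁ , u₂ + v₂

  det : C × C → C × C → C
  det (u₁ , u₂) (v₁ , v₂) = u₁ * v₂ - u₂ * v₁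

  e₁ e₂ : C × C
  e₁ = 1# , 0#
  e₂ = 0# , 1#

  values : {B : Set} → (C × C → B) → C × C → C × C → B × B × B × B
  values q u v = q u , q v , q (u ⊞ v) , q (u ⊞ ρ ⋆ v)

  α β γ δ : C × C × C × C → C
  α (a , b , c , d) = b + c + d - 2# * a
  β (a , b , c , d) = a + c + d - 2# * b
  γ (a , b , c , d) = a + b + d - 2# * c
  δ (a , b , c , d) = a + b + c - 2# * d

  interpolate : C × C × C × C → C → C → C
  interpolate w x y = ⅓ * (β w * norm x + α w * norm y + γ w * norm (x - y) + δ w * norm (ρ * x - y))

  discQuadratic discLinear : C × C × C × C → C
  discQuadratic (a , b , c , d) =
    a * a + b * b + c * c + d * d - a * b - a * c - a * d - b * c - b * d - c * d
  discLinear w@(a , b , c , d) = - ((α w * a + β w * b + γ w * c + δ w * d) * ½)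

K-operations : KOperations K
K-operations = record
  { _+_ = _+ₖ_ ; _*_ = _*ₖ_ ; -_ = -ₖ_ ; conjugate = conj ; real = λ x → ιℚ (re x)
  ; 0# = ιℚ 0ℚ ; 1# = ιℚ 1ℚ ; 2# = twoₖ ; ⅓ = ⅓ₖ ; ½ = ½ₖ ; ρ = ρₖ }

open Formulas K-operations
  using (_⋆_; det; sesquilinear; e₁; e₂; values; interpolate; discQuadratic; discLinear)

coefficients : HermForm → K × K × K
coefficients f = ιℚ (a' f) , ιℚ (c' f) , ν f

-- g(x, y) = f(x U + y V); hermitian forms take real values, so re loses nothing
pullback : HermForm → K × K → K × K → HermForm
pullback f U V = hermForm (re (evalForm f U)) (re (evalForm f V)) (sesquilinear (coefficients f) U V)

ιA-homo-+ : ∀ a b → ιA (a +ᴬ b) ≡ ιA a +ₖ ιA b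
ιA-homo-+ (m +ρᴬ n) (m' +ρᴬ n') = cong₂ _+ρ_ (toℚ-homo-+ m m') (toℚ-homo-+ n n')

ιA-homo‿- : ∀ a → ιA (-ᴬ a) ≡ -ₖ ιA a
ιA-homo‿- (m +ρᴬ n) = cong₂ _+ρ_ (toℚ-homo‿- m) (toℚ-homo‿- n)

ιA-homo-* : ∀ a b → ιA (a *ᴬ b) ≡ ιA a *ₖ ιA b
ιA-homo-* (m +ρᴬ n) (m' +ρᴬ n') = cong₂ _+ρ_
  (trans (toℚ-homo-+ (m ℤ.* m') (ℤ.- (n ℤ.* n')))
    (cong₂ ℚ._+_ (toℚ-homo-* m m') (trans (toℚ-homo‿- (n ℤ.* n')) (cong ℚ.-_ (toℚ-homo-* n n')))))
  (trans (toℚ-homo-+ (m ℤ.* n' ℤ.+ n ℤ.* m') (n ℤ.* n'))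
    (cong₂ ℚ._+_ (trans (toℚ-homo-+ (m ℤ.* n') (n ℤ.* m')) (cong₂ ℚ._+_ (toℚ-homo-* m n') (toℚ-homo-* n m')))
                 (toℚ-homo-* n n')))

Nℚ-ιA : ∀ w → Nℚ (ιA w) ≡ toℚ (normᴬ w)
Nℚ-ιA (m +ρᴬ n) = sym (trans (toℚ-homo-+ (m ℤ.* m ℤ.+ m ℤ.* n) (n ℤ.* n))
  (cong₂ ℚ._+_ (trans (toℚ-homo-+ (m ℤ.* m) (m ℤ.* n)) (cong₂ ℚ._+_ (toℚ-homo-* m m) (toℚ-homo-* m n)))
               (toℚ-homo-* n n)))

ιA²-homo-+ : ∀ u v → ιA² (u +² v) ≡ ιA² u +ₖ² ιA² v
ιA²-homo-+ (u₁ , u₂) (v₁ , v₂) = cong₂ _,_ (ιA-homo-+ u₁ v₁) (ιA-homo-+ u₂ v₂)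

ιA²-homo-· : ∀ a u → ιA² (a ·² u) ≡ ιA a ⋆ ιA² u
ιA²-homo-· a (u₁ , u₂) = cong₂ _,_ (ιA-homo-* a u₁) (ιA-homo-* a u₂)

ιA-detᴬ : ∀ u v → ιA (detᴬ u v) ≡ det (ιA² u) (ιA² v)
ιA-detᴬ (u₁ , u₂) (v₁ , v₂) = trans (ιA-homo-+ (u₁ *ᴬ v₂) (-ᴬ (u₂ *ᴬ v₁)))
  (cong₂ _+ₖ_ (ιA-homo-* u₁ v₂) (trans (ιA-homo‿- (u₂ *ᴬ v₁)) (cong -ₖ_ (ιA-homo-* u₂ v₁))))

ℚ-ring : ACR.AlmostCommutativeRing 0ℓ 0ℓ
ℚ-ring = ACR.fromCommutativeRing ℚP.+-*-commutativeRing (λ x → dec⇒maybe (0ℚ ℚ.≟ x))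

open import Tactic.RingSolver.NonReflective ℚ-ring using (Expr; Κ; Ι; _⊕_; _⊗_; ⊝_; module Ops)

-- an element of k as expressions for its two coordinates in the basis (1, ρ)
KExpr : ℕ → Set
KExpr n = Expr ℚ n × Expr ℚ n

coordinates : ∀ {n} → Vec K n → Vec ℚ (n ℕ.* 2)
coordinates [] = []
coordinates (x ∷ xs) = re x ∷ im x ∷ coordinates xs

⟦_⟧ₖ : ∀ {n} → KExpr (n ℕ.* 2) → Vec K n → K
⟦ p , q ⟧ₖ xs = Ops.⟦ p ⟧ (coordinates xs) +ρ Ops.⟦ q ⟧ (coordinates xs)

NormalFormsAgree : ∀ {n} → Vec K n → KExpr (n ℕ.* 2) → KExpr (n ℕ.* 2) → Set
NormalFormsAgree xs (p , q) (r , s) =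
  Ops.⟦ p ⇓⟧ (coordinates xs) ≡ Ops.⟦ r ⇓⟧ (coordinates xs) ×
  Ops.⟦ q ⇓⟧ (coordinates xs) ≡ Ops.⟦ s ⇓⟧ (coordinates xs)

proveₖ : ∀ {n} (xs : Vec K n) (l r : KExpr (n ℕ.* 2)) → NormalFormsAgree xs l r → ⟦ l ⟧ₖ xs ≡ ⟦ r ⟧ₖ xs
proveₖ xs (p , q) (r , s) (p≡r , q≡s) =
  cong₂ _+ρ_ (Ops.prove (coordinates xs) p r p≡r) (Ops.prove (coordinates xs) q s q≡s)

re-index im-index : ∀ {n} → Fin n → Fin (n ℕ.* 2)
re-index zero    = zero
re-index (suc i) = suc (suc (re-index i))
im-index zero    = suc zero
im-index (suc i) = suc (suc (im-index i))

kvar : ∀ {n} → Fin n → KExpr (n ℕ.* 2)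
kvar i = Ι (re-index i) , Ι (im-index i)

KExpr-operations : ∀ {n} → KOperations (KExpr n)
KExpr-operations = record
  { _+_ = λ { (p , q) (r , s) → p ⊕ r , q ⊕ s }
  ; _*_ = λ { (p , q) (r , s) → p ⊗ r ⊕ ⊝ (q ⊗ s) , p ⊗ s ⊕ q ⊗ r ⊕ q ⊗ s }
  ; -_ = λ { (p , q) → ⊝ p , ⊝ q }
  ; conjugate = λ { (p , q) → p ⊕ q , ⊝ q }
  ; real = λ { (p , _) → p , Κ 0ℚ }
  ; 0# = constant 0ℚ ; 1# = constant 1ℚ ; 2# = constant (+ 2 ℚ./ 1)
  ; ⅓ = constant (+ 1 ℚ./ 3) ; ½ = constant (+ 1 ℚ./ 2) ; ρ = Κ 0ℚ , Κ 1ℚ }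
  where
  constant : ℚ → KExpr _
  constant p = Κ p , Κ 0ℚ

open module KExprFormulas {n} = Formulas (KExpr-operations {n})
  using () renaming
  ( _⋆_ to _⋆ᵉ_; _⊞_ to _⊞ᵉ_; form to formᵉ; pullback to pullbackᵉ; det to detᵉ
  ; e₁ to e₁ᵉ; e₂ to e₂ᵉ; values to valuesᵉ; interpolate to interpolateᵉ
  ; discQuadratic to discQuadraticᵉ; discLinear to discLinearᵉ)

open module KExprOperations {n} = KOperations (KExpr-operations {n})
  using () renaming (_*_ to _*ᵉ_; ρ to ρᵉ)

Nℚᵉ : ∀ {n} → KExpr n → Expr ℚ n
Nℚᵉ (p , q) = p ⊗ p ⊕ p ⊗ q ⊕ q ⊗ q

discᵉ : ∀ {n} → KExpr n × KExpr n × KExpr n → Expr ℚ n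
discᵉ ((a , _) , (c , _) , ν) = Κ Dk ⊗ (a ⊗ c ⊕ ⊝ Nℚᵉ ν)

-- a' and c' are rational, so they enter as variables of k with imaginary part 0: the identities
-- below fail for general complex a', c'.
coefficientsᵉ : ∀ {n} → let m = (3 ℕ.+ n) ℕ.* 2 in KExpr m × KExpr m × KExpr m
coefficientsᵉ {n} = rational zero , rational (suc zero) , kvar {3 ℕ.+ n} (suc (suc zero))
  where
  rational : Fin (3 ℕ.+ n) → KExpr ((3 ℕ.+ n) ℕ.* 2)
  rational i = Ι (re-index i) , Κ 0ℚ

withCoefficients : ∀ {n} → HermForm → Vec K n → Vec K (3 ℕ.+ n)
withCoefficients f xs = ιℚ (a' f) ∷ ιℚ (c' f) ∷ ν f ∷ xs

Nℚ-homo-* : ∀ x y → Nℚ (x *ₖ y) ≡ Nℚ x ℚ.* Nℚ y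
Nℚ-homo-* x y = Ops.prove (coordinates (x ∷ y ∷ [])) (Nℚᵉ (x' *ᵉ y')) (Nℚᵉ x' ⊗ Nℚᵉ y') refl
  where
  v = kvar {2}
  x' y' : KExpr 4
  x' = v (# 0)
  y' = v (# 1)

det-⋆ : ∀ U V x₁ y₁ x₂ y₂ →
  det (x₁ ⋆ U +ₖ² y₁ ⋆ V) (x₂ ⋆ U +ₖ² y₂ ⋆ V) ≡ det U V *ₖ det (x₁ , y₁) (x₂ , y₂)
det-⋆ (U₁ , U₂) (V₁ , V₂) x₁ y₁ x₂ y₂ =
  proveₖ (U₁ ∷ U₂ ∷ V₁ ∷ V₂ ∷ x₁ ∷ y₁ ∷ x₂ ∷ y₂ ∷ [])
    (detᵉ (x₁' ⋆ᵉ U ⊞ᵉ y₁' ⋆ᵉ V) (x₂' ⋆ᵉ U ⊞ᵉ y₂' ⋆ᵉ V)) (detᵉ U V *ᵉ detᵉ (x₁' , y₁') (x₂' , y₂'))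
    (refl , refl)
  where
  v = kvar {8}
  U V : KExpr 16 × KExpr 16
  U = v (# 0) , v (# 1)
  V = v (# 2) , v (# 3)
  x₁' y₁' x₂' y₂' : KExpr 16
  x₁' = v (# 4)
  y₁' = v (# 5)
  x₂' = v (# 6)
  y₂' = v (# 7)

evalForm-pullback : ∀ f U V x y → evalForm f (x ⋆ U +ₖ² y ⋆ V) ≡ evalForm (pullback f U V) (x , y)
evalForm-pullback f (U₁ , U₂) (V₁ , V₂) x y =
  proveₖ (withCoefficients f (U₁ ∷ U₂ ∷ V₁ ∷ V₂ ∷ x ∷ y ∷ []))
    (formᵉ f' (x' ⋆ᵉ U ⊞ᵉ y' ⋆ᵉ V)) (formᵉ (pullbackᵉ f' U V) (x' , y')) (refl , refl)
  where
  v = kvar {9}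
  f' = coefficientsᵉ {6}
  U V : KExpr 18 × KExpr 18
  U = v (# 3) , v (# 4)
  V = v (# 5) , v (# 6)
  x' y' : KExpr 18
  x' = v (# 7)
  y' = v (# 8)

combination-values : ∀ U V →
  values (λ w → proj₁ w ⋆ U +ₖ² proj₂ w ⋆ V) e₁ e₂ ≡ (U , V , U +ₖ² V , U +ₖ² ρₖ ⋆ V)
combination-values (U₁ , U₂) (V₁ , V₂) =
  cong₂ _,_ (at e₁ᵉ U' (refl , refl) (refl , refl))
  (cong₂ _,_ (at e₂ᵉ V' (refl , refl) (refl , refl))
  (cong₂ _,_ (at (e₁ᵉ ⊞ᵉ e₂ᵉ) (U' ⊞ᵉ V') (refl , refl) (refl , refl))
             (at (e₁ᵉ ⊞ᵉ ρᵉ ⋆ᵉ e₂ᵉ) (U' ⊞ᵉ ρᵉ ⋆ᵉ V') (refl , refl) (refl , refl))))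
  where
  xs = U₁ ∷ U₂ ∷ V₁ ∷ V₂ ∷ []
  v = kvar {4}
  U' V' : KExpr 8 × KExpr 8
  U' = v (# 0) , v (# 1)
  V' = v (# 2) , v (# 3)
  lin : KExpr 8 × KExpr 8 → KExpr 8 × KExpr 8
  lin w = proj₁ w ⋆ᵉ U' ⊞ᵉ proj₂ w ⋆ᵉ V'
  at : (w W : KExpr 8 × KExpr 8) →
       NormalFormsAgree xs (proj₁ (lin w)) (proj₁ W) → NormalFormsAgree xs (proj₂ (lin w)) (proj₂ W) →
       (⟦ proj₁ (lin w) ⟧ₖ xs , ⟦ proj₂ (lin w) ⟧ₖ xs) ≡ (⟦ proj₁ W ⟧ₖ xs , ⟦ proj₂ W ⟧ₖ xs)
  at w W agree₁ agree₂ =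
    cong₂ _,_ (proveₖ xs (proj₁ (lin w)) (proj₁ W) agree₁) (proveₖ xs (proj₂ (lin w)) (proj₂ W) agree₂)

values-cong : ∀ {B : Set} {q q' : K × K → B} → (∀ w → q w ≡ q' w) → ∀ U V → values q U V ≡ values q' U V
values-cong q≗q' U V = cong₂ _,_ (q≗q' _) (cong₂ _,_ (q≗q' _) (cong₂ _,_ (q≗q' _) (q≗q' _)))

pullback-values : ∀ f U V → values (evalForm (pullback f U V)) e₁ e₂ ≡ values (evalForm f) U V
pullback-values f U V = begin
  values (evalForm (pullback f U V)) e₁ e₂                        ≡⟨ values-cong (λ w → sym (evalForm-pullback f U V (proj₁ w) (proj₂ w))) e₁ e₂ ⟩
  values (λ w → evalForm f (proj₁ w ⋆ U +ₖ² proj₂ w ⋆ V)) e₁ e₂   ≡⟨ cong (λ { (a , b , c , d) → evalForm f a , evalForm f b , evalForm f c , evalForm f d })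
                                                                          (combination-values U V) ⟩
  values (evalForm f) U V                                         ∎

disc-pullback : ∀ f U V → disc (pullback f U V) ≡ Nℚ (det U V) ℚ.* disc f
disc-pullback f (U₁ , U₂) (V₁ , V₂) =
  Ops.prove (coordinates (withCoefficients f (U₁ ∷ U₂ ∷ V₁ ∷ V₂ ∷ [])))
    (discᵉ (pullbackᵉ f' U V)) (Nℚᵉ (detᵉ U V) ⊗ discᵉ f') refl
  where
  v = kvar {7}
  f' = coefficientsᵉ {4}
  U V : KExpr 14 × KExpr 14
  U = v (# 3) , v (# 4)
  V = v (# 5) , v (# 6)

standardValuesᵉ : ∀ {n} → let m = (3 ℕ.+ n) ℕ.* 2 in KExpr m × KExpr m × KExpr m × KExpr m
standardValuesᵉ {n} = valuesᵉ (formᵉ (coefficientsᵉ {n})) e₁ᵉ e₂ᵉ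

module _ (g : HermForm) where
  evalForm-interpolation : ∀ x y → evalForm g (x , y) ≡ interpolate (values (evalForm g) e₁ e₂) x y
  evalForm-interpolation x y =
    proveₖ (withCoefficients g (x ∷ y ∷ []))
      (formᵉ (coefficientsᵉ {2}) (x' , y')) (interpolateᵉ (standardValuesᵉ {2}) x' y') (refl , refl)
    where
    x' y' : KExpr 10
    x' = kvar {5} (# 3)
    y' = kvar {5} (# 4)

  disc-quadratic : ιℚ (disc g) ≡ discQuadratic (values (evalForm g) e₁ e₂)
  disc-quadratic = proveₖ (withCoefficients g [])
    (discᵉ (coefficientsᵉ {0}) , Κ 0ℚ) (discQuadraticᵉ (standardValuesᵉ {0})) (refl , refl)

  disc-linear : ιℚ (disc g) ≡ discLinear (values (evalForm g) e₁ e₂)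
  disc-linear = proveₖ (withCoefficients g [])
    (discᵉ (coefficientsᵉ {0}) , Κ 0ℚ) (discLinearᵉ (standardValuesᵉ {0})) (refl , refl)

-- Writing e₁ = x₁ u + y₁ v and e₂ = x₂ u + y₂ v gives det(u, v) det(X, Y) = det(e₁, e₂) = 1 in A,
-- so N(det(u, v)) is a non-negative integer dividing 1.
basis⇒unimodular : ∀ u v → IsBasis u v → Nℚ (det (ιA² u) (ιA² v)) ≡ 1ℚ
basis⇒unimodular u v basis with basis (oneᴬ , zeroᴬ) | basis (zeroᴬ , oneᴬ)
... | (x₁ , y₁) , e₁≡ , _ | (x₂ , y₂) , e₂≡ , _ = begin
  Nℚ (det U V)            ≡⟨ cong Nℚ (ιA-detᴬ u v) ⟨
  Nℚ (ιA (detᴬ u v))      ≡⟨ Nℚ-ιA (detᴬ u v) ⟩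
  toℚ (normᴬ (detᴬ u v))  ≡⟨ cong toℚ (nonNeg-unit (normᴬ (detᴬ X Y)) (normᴬ-nonNeg (detᴬ u v)) norms-inverse) ⟩
  1ℚ                      ∎
  where
  U = ιA² u
  V = ιA² v
  X = x₁ , y₁
  Y = x₂ , y₂
  ιA²-coordinates : ∀ x y w → (x ·² u) +² (y ·² v) ≡ w → ιA x ⋆ U +ₖ² ιA y ⋆ V ≡ ιA² w
  ιA²-coordinates x y w eq =
    trans (sym (trans (ιA²-homo-+ (x ·² u) (y ·² v)) (cong₂ _+ₖ²_ (ιA²-homo-· x u) (ιA²-homo-· y v))))
          (cong ιA² eq)
  dets-inverse : det U V *ₖ det (ιA² X) (ιA² Y) ≡ ιℚ 1ℚ
  dets-inverse = begin
    det U V *ₖ det (ιA² X) (ιA² Y)                                   ≡⟨ det-⋆ U V (ιA x₁) (ιA y₁) (ιA x₂) (ιA y₂) ⟨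
    det (ιA x₁ ⋆ U +ₖ² ιA y₁ ⋆ V) (ιA x₂ ⋆ U +ₖ² ιA y₂ ⋆ V)          ≡⟨ cong₂ det (ιA²-coordinates x₁ y₁ _ e₁≡) (ιA²-coordinates x₂ y₂ _ e₂≡) ⟩
    det (ιA² (oneᴬ , zeroᴬ)) (ιA² (zeroᴬ , oneᴬ))                    ≡⟨⟩
    ιℚ 1ℚ                                                            ∎
  norms-inverse : normᴬ (detᴬ u v) ℤ.* normᴬ (detᴬ X Y) ≡ 1ℤ
  norms-inverse = toℚ-injective (begin
    toℚ (normᴬ (detᴬ u v) ℤ.* normᴬ (detᴬ X Y))           ≡⟨ toℚ-homo-* (normᴬ (detᴬ u v)) (normᴬ (detᴬ X Y)) ⟩
    toℚ (normᴬ (detᴬ u v)) ℚ.* toℚ (normᴬ (detᴬ X Y))     ≡⟨ cong₂ ℚ._*_ (Nℚ-ιA (detᴬ u v)) (Nℚ-ιA (detᴬ X Y)) ⟨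
    Nℚ (ιA (detᴬ u v)) ℚ.* Nℚ (ιA (detᴬ X Y))             ≡⟨ Nℚ-homo-* (ιA (detᴬ u v)) (ιA (detᴬ X Y)) ⟨
    Nℚ (ιA (detᴬ u v) *ₖ ιA (detᴬ X Y))                   ≡⟨ cong Nℚ (cong₂ _*ₖ_ (ιA-detᴬ u v) (ιA-detᴬ X Y)) ⟩
    Nℚ (det U V *ₖ det (ιA² X) (ιA² Y))                   ≡⟨ cong Nℚ dets-inverse ⟩
    Nℚ (ιℚ 1ℚ)                                            ≡⟨⟩
    toℚ 1ℤ                                                ∎)

ValueFormulas : HermForm → K × K → K × K → K × K × K × K → Set
ValueFormulas f U V w =
  ((x y : K) → evalForm f (x ⋆ U +ₖ² y ⋆ V) ≡ interpolate w x y) ×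
  ιℚ (disc f) ≡ discQuadratic w × ιℚ (disc f) ≡ discLinear w

value-formulas : ∀ f U V → Nℚ (det U V) ≡ 1ℚ → ValueFormulas f U V (values (evalForm f) U V)
value-formulas f U V unimodular =
  interpolation , transport discQuadratic (disc-quadratic g) , transport discLinear (disc-linear g)
  where
  g = pullback f U V
  interpolation : ∀ x y → evalForm f (x ⋆ U +ₖ² y ⋆ V) ≡ interpolate (values (evalForm f) U V) x y
  interpolation x y = begin
    evalForm f (x ⋆ U +ₖ² y ⋆ V)                   ≡⟨ evalForm-pullback f U V x y ⟩
    evalForm g (x , y)                             ≡⟨ evalForm-interpolation g x y ⟩
    interpolate (values (evalForm g) e₁ e₂) x y    ≡⟨ cong (λ w → interpolate w x y) (pullback-values f U V) ⟩
    interpolate (values (evalForm f) U V) x y      ∎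
  disc-invariant : disc g ≡ disc f
  disc-invariant = begin
    disc g                     ≡⟨ disc-pullback f U V ⟩
    Nℚ (det U V) ℚ.* disc f    ≡⟨ cong (ℚ._* disc f) unimodular ⟩
    1ℚ ℚ.* disc f              ≡⟨ ℚP.*-identityˡ (disc f) ⟩
    disc f                     ∎
  transport : (F : K × K × K × K → K) → ιℚ (disc g) ≡ F (values (evalForm g) e₁ e₂) →
              ιℚ (disc f) ≡ F (values (evalForm f) U V)
  transport F eq = trans (cong ιℚ (sym disc-invariant)) (trans eq (cong F (pullback-values f U V)))

ιA²-values : ∀ (q : K × K → K) u v →
  values q (ιA² u) (ιA² v) ≡ (q (ιA² u) , q (ιA² v) , q (ιA² (u +² v)) , q (ιA² (u +² (ρᴬ ·² v))))
ιA²-values q u v = cong₂ (λ c d → q (ιA² u) , q (ιA² v) , c , d)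
  (cong q (sym (ιA²-homo-+ u v)))
  (cong q (sym (trans (ιA²-homo-+ u (ρᴬ ·² v)) (cong (ιA² u +ₖ²_) (ιA²-homo-· ρᴬ v)))))

proposition8p1 : (f : HermForm) → IsIntegral f → (u v : A²) → IsBasis u v →
    let a = evalForm f (ιA² u)
        b = evalForm f (ιA² v)
        c = evalForm f (ιA² (u +² v))
        d = evalForm f (ιA² (u +² (ρᴬ ·² v)))
        α = b +ₖ c +ₖ d -ₖ twoₖ *ₖ a
        β = a +ₖ c +ₖ d -ₖ twoₖ *ₖ b
        γ = a +ₖ b +ₖ d -ₖ twoₖ *ₖ c
        δ = a +ₖ b +ₖ c -ₖ twoₖ *ₖ d
    in ((x y : K) → evalForm f ((x ·ₖ u) +ₖ² (y ·ₖ v))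
          ≡ ⅓ₖ *ₖ (β *ₖ N x +ₖ α *ₖ N y +ₖ γ *ₖ N (x -ₖ y) +ₖ δ *ₖ N (ρₖ *ₖ x -ₖ y)))
       × (ιℚ (disc f) ≡ a *ₖ a +ₖ b *ₖ b +ₖ c *ₖ c +ₖ d *ₖ d
            -ₖ a *ₖ b -ₖ a *ₖ c -ₖ a *ₖ d -ₖ b *ₖ c -ₖ b *ₖ d -ₖ c *ₖ d)
       × (ιℚ (disc f) ≡ -ₖ ((α *ₖ a +ₖ β *ₖ b +ₖ γ *ₖ c +ₖ δ *ₖ d) *ₖ ½ₖ))
proposition8p1 f _ u v basis =
  subst (ValueFormulas f (ιA² u) (ιA² v)) (ιA²-values (evalForm f) u v)
    (value-formulas f (ιA² u) (ιA² v) (basis⇒unimodular u v basis))
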